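{- Let $k$ be a positive integer and let $s$ be an even positive integer. Then there exists a hypergraph $\mathcal{F}$, all of whose hyperedges have size greater than $s$, with $\chi\left({\rm KG}^2(\mathcal{F}, s)\right) = k$, such that $${\rm cd}^2(\mathcal{F}, l) = {\rm ecd}^2(\mathcal{F}, l) = k(2l - s + 1)$$ for each $l \in \left\{\frac{s}{2} + 1, \frac{s}{2} + 2, \dots, s\right\}$.
   Context: A hypergraph $\mathcal{F}$ consists of a finite vertex set $V(\mathcal{F})$ and a set $E(\mathcal{F}) \subseteq 2^{V(\mathcal{F})} \setminus \{\varnothing\}$ of hyperedges. For an integer $r \geq 2$ and a nonnegative integer $s$ with $s < |e|$ for every hyperedge $e$ of $\mathcal{F}$, the generalized Kneser hypergraph ${\rm KG}^r(\mathcal{F}, s)$ is the $r$-uniform hypergraph with vertex set $E(\mathcal{F})$, in which $r$ hyperedges $e_1, \dots, e_r$ of $\mathcal{F}$ form a hyperedge iff $|e_i \cap e_j| \leq s$ for all distinct $i, j \in \{1, \dots, r\}$. Its chromatic number $\chi$ is the minimum cardinality of a set $C$ admitting a map $f: E(\mathcal{F}) \to C$ such that $|\{f(e_1), \dots, f(e_r)\}| \geq 2$ for every hyperedge $\{e_1, \dots, e_r\}$ of ${\rm KG}^r(\mathcal{F}, s)$. For sets $A, B$ and a nonnegative integer $s$, write $A \subseteq_s B$ if $|A \setminus B| \leq s$. For a nonnegative integer $x$ with $x < |e|$ for all hyperedges $e$: the $x$-th $r$-colorability defect ${\rm cd}^r(\mathcal{F}, x)$ is the minimum size of a subset $X_0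 \subseteq V(\mathcal{F})$ for which there is a partition $\{X_1, \dots, X_r\}$ of $V(\mathcal{F}) \setminus X_0$ (parts may be empty) such that $e \not\subseteq_x X_i$ for every hyperedge $e$ and every $i \in \{1, \dots, r\}$; the $x$-th equitable $r$-colorability defect ${\rm ecd}^r(\mathcal{F}, x)$ is defined in the same way with the additional requirement that $\bigl||X_i| - |X_j|\bigr| \leq 1$ for all $1 \leq i < j \leq r$. -}

module Defs where

open import Data.Nat using (ℕ; zero; suc; _+_; _*_; _∸_; _≤_; _<_)
open import Data.Fin using (Fin)
open import Data.Fin.Subset using (Subset; ∣_∣; _∩_; _─_; Nonempty)
open import Data.Vec using (tabulate)
open import Data.Product using (Σ; _×_; ∃)
open import Relation.Binary.PropositionalEquality using (_≡_; _≢_)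
open import Relation.Nullary using (does; ¬_)
open import Data.Empty using (⊥)
open import Function.Definitions using (Injective)
import Data.Fin as F

-- A hypergraph: vertex set Fin n, hyperedge set given by an injective
-- enumeration edge : Fin m → Subset n of nonempty subsets (so E(F) is a
-- set of nonempty subsets of V(F), with m = |E(F)|).
record Hypergraph : Set where
  field
    n        : ℕ
    m        : ℕ
    edge     : Fin m → Subset n
    edge-inj : Injective _≡_ _≡_ edge
    edge-ne  : (i : Fin m) → Nonempty (edge i)

open Hypergraph public

IsMinimum : (ℕ → Set) → ℕ → Set
IsMinimum P k = P k × ((c : ℕ) → P c → k ≤ c)

-- A proper colouring of KG^2(F, s) with c colours: two distinct hyperedges
-- e_i, e_j with |e_i ∩ e_j| ≤ s (i.e. adjacent in KG^2(F,s)) get different colours.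
ProperKGColouring : (F : Hypergraph) → ℕ → (c : ℕ) → (Fin (m F) → Fin c) → Set
ProperKGColouring F s c f =
  (i j : Fin (m F)) → i ≢ j → ∣ edge F i ∩ edge F j ∣ ≤ s → f i ≢ f j

KGColourable : Hypergraph → ℕ → ℕ → Set
KGColourable F s c = Σ (Fin (m F) → Fin c) (ProperKGColouring F s c)

chiKG2 : Hypergraph → ℕ → ℕ → Set
chiKG2 F s k = IsMinimum (KGColourable F s) k

_⊆[_]_ : {n : ℕ} → Subset n → ℕ → Subset n → Set
A ⊆[ s ] B = ∣ A ─ B ∣ ≤ s

-- Partition of V(F) into X_0, X_1, X_2 encoded by g : V(F) → Fin 3
-- (g v = 0 means v ∈ X_0, g v = 1 means v ∈ X_1, g v = 2 means v ∈ X_2).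
part : {n : ℕ} → (Fin n → Fin 3) → Fin 3 → Subset n
part g i = tabulate (λ v → does (g v F.≟ i))

Good : (F : Hypergraph) → ℕ → (Fin (n F) → Fin 3) → Set
Good F x g = (j : Fin (m F)) → (i : Fin 3) → i ≢ F.zero →
  ¬ (edge F j ⊆[ x ] part g i)

CdWitness : Hypergraph → ℕ → ℕ → Set
CdWitness F x d = Σ (Fin (n F) → Fin 3) λ g →
  Good F x g × ∣ part g F.zero ∣ ≡ d

Balanced : {n : ℕ} → (Fin n → Fin 3) → Set
Balanced g = ∣ part g (F.suc F.zero) ∣ ≤ suc ∣ part g (F.suc (F.suc F.zero)) ∣
           × ∣ part g (F.suc (F.suc F.zero)) ∣ ≤ suc ∣ part g (F.suc F.zero) ∣

EcdWitness : Hypergraph → ℕ → ℕ → Set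
EcdWitness F x d = Σ (Fin (n F) → Fin 3) λ g →
  Good F x g × Balanced g × ∣ part g F.zero ∣ ≡ d

cd2 : Hypergraph → ℕ → ℕ → Set
cd2 F x d = IsMinimum (CdWitness F x) d

ecd2 : Hypergraph → ℕ → ℕ → Set
ecd2 F x d = IsMinimum (EcdWitness F x) d

-- The witness is k pairwise disjoint edges of size s + 1. Distinct edges are
-- then adjacent in KG²(F, s), so KG²(F, s) is complete and χ = k.
-- For the defect, every vertex of an edge e lies outside X₁ or outside X₂, and
-- outside both exactly when it lies in X₀; hence
--   |e ∖ X₁| + |e ∖ X₂| = |e| + |e ∩ X₀|.
-- If e ⊈ₗ X₁ and e ⊈ₗ X₂, the left side is at least 2(l + 1), so e meets X₀ in
-- at least 2l − s + 1 vertices, and summing over the disjoint edges bounds |X₀|.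
-- Equality, with |X₁| = |X₂|, comes from colouring every edge alike: 2l − s + 1
-- vertices into X₀ and s − l into each of X₁ and X₂.
module Submission where

open import Defs
open import Data.Nat using (ℕ; suc; _+_; _*_; _∸_; _≤_; _<_)
open import Data.Nat.DivMod using (_/_)
open import Data.Nat.Divisibility using (_∣_)
open import Data.Fin.Subset using (∣_∣)
open import Data.Product using (Σ; _×_)

open import Data.Nat using (zero; z≤n)
open import Data.Nat.Properties
open import Data.Nat.DivMod using (m/n*n≡m)
open import Data.Nat.Solver using (module +-*-Solver)
open import Data.Bool using (Bool)
open import Data.Fin as F using (Fin; #_)
open import Data.Fin.Properties using (injective⇒≤)
open import Data.Fin.Subset using (Subset; inside; outside; ⊤; ⊥; ∁; _∩_; _─_; Nonempty)
open import Data.Fin.Subset.Properties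
  using (∣⊤∣≡n; ∣⊥∣≡0; ∣∁p∣≡n∸∣p∣; ∩-identityˡ; ∩-zeroˡ; ∩-zeroʳ)
open import Data.Vec using (Vec; []; _∷_; _++_; concat; replicate; map; lookup; splitAt; here; there)
open import Data.Vec.Properties
  using (zipWith-++; map-++; map-replicate; map-concat; tabulate-∘; tabulate∘lookup; ++-injectiveʳ)
open import Data.Product using (_,_)
open import Relation.Binary.PropositionalEquality
open import Function using (id; _∘_)
open import Function.Definitions using (Injective)
open import Relation.Nullary using (does; contradiction)
open import Relation.Nullary.Decidable using (decidable-stable)

open +-*-Solver using (solve; _:+_; _:=_; con)
open ≡-Reasoning

∣p++q∣≡∣p∣+∣q∣ : ∀ {m n} (p : Subset m) (q : Subset n) → ∣ p ++ q ∣ ≡ ∣ p ∣ + ∣ q ∣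
∣p++q∣≡∣p∣+∣q∣ []            q = refl
∣p++q∣≡∣p∣+∣q∣ (inside  ∷ p) q = cong suc (∣p++q∣≡∣p∣+∣q∣ p q)
∣p++q∣≡∣p∣+∣q∣ (outside ∷ p) q = ∣p++q∣≡∣p∣+∣q∣ p q

∣p++q∩r++s∣ : ∀ {m n} (p r : Subset m) (q s : Subset n) →
  ∣ (p ++ q) ∩ (r ++ s) ∣ ≡ ∣ p ∩ r ∣ + ∣ q ∩ s ∣
∣p++q∩r++s∣ p r q s = trans (cong ∣_∣ (zipWith-++ _ p q r s)) (∣p++q∣≡∣p∣+∣q∣ (p ∩ r) (q ∩ s))

∣p++q─r++s∣ : ∀ {m n} (p r : Subset m) (q s : Subset n) →
  ∣ (p ++ q) ─ (r ++ s) ∣ ≡ ∣ p ─ r ∣ + ∣ q ─ s ∣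
∣p++q─r++s∣ p r q s = trans (cong ∣_∣ (zipWith-++ _ p q r s)) (∣p++q∣≡∣p∣+∣q∣ (p ─ r) (q ─ s))

∣⊥∩p∣≡0 : ∀ {n} (p : Subset n) → ∣ ⊥ ∩ p ∣ ≡ 0
∣⊥∩p∣≡0 {n} p = trans (cong ∣_∣ (∩-zeroˡ p)) (∣⊥∣≡0 n)

∣p∩⊥∣≡0 : ∀ {n} (p : Subset n) → ∣ p ∩ ⊥ ∣ ≡ 0
∣p∩⊥∣≡0 {n} p = trans (cong ∣_∣ (∩-zeroʳ p)) (∣⊥∣≡0 n)

⊤─p≡∁p : ∀ {n} (p : Subset n) → ⊤ ─ p ≡ ∁ p
⊤─p≡∁p []            = refl
⊤─p≡∁p (inside  ∷ p) = cong (outside ∷_) (⊤─p≡∁p p)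
⊤─p≡∁p (outside ∷ p) = cong (inside ∷_) (⊤─p≡∁p p)

⊥─p≡⊥ : ∀ {n} (p : Subset n) → ⊥ ─ p ≡ ⊥
⊥─p≡⊥ []            = refl
⊥─p≡⊥ (inside  ∷ p) = cong (outside ∷_) (⊥─p≡⊥ p)
⊥─p≡⊥ (outside ∷ p) = cong (outside ∷_) (⊥─p≡⊥ p)

p─q≡p∩∁q : ∀ {n} (p q : Subset n) → p ─ q ≡ p ∩ ∁ q
p─q≡p∩∁q []            []            = refl
p─q≡p∩∁q (inside  ∷ p) (inside  ∷ q) = cong (outside ∷_) (p─q≡p∩∁q p q)
p─q≡p∩∁q (outside ∷ p) (inside  ∷ q) = cong (outside ∷_) (p─q≡p∩∁q p q)
p─q≡p∩∁q (inside  ∷ p) (outside ∷ q) = cong (inside ∷_) (p─q≡p∩∁q p q)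
p─q≡p∩∁q (outside ∷ p) (outside ∷ q) = cong (outside ∷_) (p─q≡p∩∁q p q)

∣concat-replicate∣ : ∀ k {n} (p : Subset n) → ∣ concat (replicate k p) ∣ ≡ k * ∣ p ∣
∣concat-replicate∣ zero    p = refl
∣concat-replicate∣ (suc k) p =
  trans (∣p++q∣≡∣p∣+∣q∣ p _) (cong (∣ p ∣ +_) (∣concat-replicate∣ k p))

++-nonemptyʳ : ∀ {m n} (p : Subset m) {q : Subset n} → Nonempty q → Nonempty (p ++ q)
++-nonemptyʳ []      q≠∅ = q≠∅
++-nonemptyʳ (x ∷ p) q≠∅ with ++-nonemptyʳ p q≠∅
... | i , i∈p++q = F.suc i , there i∈p++q

isColour : Fin 3 → Fin 3 → Bool
isColour i c = does (c F.≟ i)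

part-lookup : ∀ {n} (c : Vec (Fin 3) n) (i : Fin 3) → part (lookup c) i ≡ map (isColour i) c
part-lookup c i =
  trans (tabulate-∘ (isColour i) (lookup c)) (cong (map (isColour i)) (tabulate∘lookup c))

-- Stated with ∩ and ∁: the helper of _─_ is local to its clause, so _─_ only
-- unfolds when the heads of both arguments are constructors, which would force
-- a split on x and g zero in every case.
∣A∩∁X₁∣+∣A∩∁X₂∣≡∣A∣+∣A∩X₀∣ : ∀ {n} (g : Fin n → Fin 3) (A : Subset n) →
  ∣ A ∩ ∁ (part g (# 1)) ∣ + ∣ A ∩ ∁ (part g (# 2)) ∣ ≡ ∣ A ∣ + ∣ A ∩ part g (# 0) ∣
∣A∩∁X₁∣+∣A∩∁X₂∣≡∣A∣+∣A∩X₀∣ g [] = refl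
∣A∩∁X₁∣+∣A∩∁X₂∣≡∣A∣+∣A∩X₀∣ g (x ∷ A)
  with g F.zero | ∣A∩∁X₁∣+∣A∩∁X₂∣≡∣A∣+∣A∩X₀∣ (λ v → g (F.suc v)) A | x
... | _                    | ih | outside = ih
... | F.zero               | ih | inside  =
  cong suc (trans (+-suc _ _) (trans (cong suc ih) (sym (+-suc _ _))))
... | F.suc F.zero         | ih | inside  = trans (+-suc _ _) (cong suc ih)
... | F.suc (F.suc F.zero) | ih | inside  = cong suc ih

∣A─X₁∣+∣A─X₂∣≡∣A∣+∣A∩X₀∣ : ∀ {n} (g : Fin n → Fin 3) (A : Subset n) →
  ∣ A ─ part g (# 1) ∣ + ∣ A ─ part g (# 2) ∣ ≡ ∣ A ∣ + ∣ A ∩ part g (# 0) ∣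
∣A─X₁∣+∣A─X₂∣≡∣A∣+∣A∩X₀∣ g A = begin
  ∣ A ─ part g (# 1) ∣ + ∣ A ─ part g (# 2) ∣
    ≡⟨ cong₂ (λ p q → ∣ p ∣ + ∣ q ∣) (p─q≡p∩∁q A _) (p─q≡p∩∁q A _) ⟩
  ∣ A ∩ ∁ (part g (# 1)) ∣ + ∣ A ∩ ∁ (part g (# 2)) ∣
    ≡⟨ ∣A∩∁X₁∣+∣A∩∁X₂∣≡∣A∣+∣A∩X₀∣ g A ⟩
  ∣ A ∣ + ∣ A ∩ part g (# 0) ∣ ∎

Good⇒a≤∣e∩X₀∣ : ∀ {F l g a b} → Good F l g → a + b ≡ suc l →
  (j : Fin (m F)) → ∣ edge F j ∣ ≡ a + (b + b) → a ≤ ∣ edge F j ∩ part g (# 0) ∣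
Good⇒a≤∣e∩X₀∣ {F} {l} {g} {a} {b} good a+b≡1+l j ∣e∣≡a+2b =
  +-cancelˡ-≤ (a + (b + b)) a c
    (subst₂ _≤_ lhs rhs (+-mono-≤ (1+l≤∣e─Xᵢ∣ (# 1) λ ()) (1+l≤∣e─Xᵢ∣ (# 2) λ ())))
  where
  e = edge F j
  c = ∣ e ∩ part g (# 0) ∣
  1+l≤∣e─Xᵢ∣ : (i : Fin 3) → i ≢ F.zero → suc l ≤ ∣ e ─ part g i ∣
  1+l≤∣e─Xᵢ∣ i i≢0 = ≰⇒> (good j i i≢0)
  lhs : suc l + suc l ≡ a + (b + b) + a
  lhs = begin
    suc l + suc l      ≡⟨ cong₂ _+_ a+b≡1+l a+b≡1+l ⟨
    (a + b) + (a + b)  ≡⟨ solve 2 (λ a b → (a :+ b) :+ (a :+ b) := (a :+ (b :+ b)) :+ a) refl a b ⟩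
    a + (b + b) + a    ∎
  rhs : ∣ e ─ part g (# 1) ∣ + ∣ e ─ part g (# 2) ∣ ≡ a + (b + b) + c
  rhs = trans (∣A─X₁∣+∣A─X₂∣≡∣A∣+∣A∩X₀∣ g e) (cong (_+ c) ∣e∣≡a+2b)

pairwise-small⇒chiKG2≡m : ∀ (F : Hypergraph) {s} →
  (∀ i j → i ≢ j → ∣ edge F i ∩ edge F j ∣ ≤ s) → chiKG2 F s (m F)
pairwise-small⇒chiKG2≡m F small = (id , λ i j i≢j _ → i≢j) , colours≥m
  where
  colours≥m : (c : ℕ) → KGColourable F _ c → m F ≤ c
  colours≥m c (f , proper) = injective⇒≤ λ {i} {j} fi≡fj →
    decidable-stable (i F.≟ j) λ i≢j → proper i j i≢j (small i j i≢j) fi≡fj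

cd2×ecd2-intro : ∀ {F x d} (g : Fin (n F) → Fin 3) →
  Good F x g → Balanced g → ∣ part g (# 0) ∣ ≡ d →
  (∀ h → Good F x h → d ≤ ∣ part h (# 0) ∣) → cd2 F x d × ecd2 F x d
cd2×ecd2-intro g good balanced ∣X₀∣≡d lower =
    ((g , good , ∣X₀∣≡d)
    , λ _ (h , good-h , ∣X₀∣≡c) → subst (_ ≤_) ∣X₀∣≡c (lower h good-h))
  , ((g , good , balanced , ∣X₀∣≡d)
    , λ _ (h , good-h , _ , ∣X₀∣≡c) → subst (_ ≤_) ∣X₀∣≡c (lower h good-h))

module Blocks (T : ℕ) where

  block : ∀ {k} → Fin k → Subset (k * T)
  block {suc k} F.zero    = ⊤ {T} ++ ⊥
  block {suc k} (F.suc i) = ⊥ {T} ++ block i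

  ∣block₀∩Y++Z∣≡∣Y∣ : ∀ {k} (Y : Subset T) (Z : Subset (k * T)) →
    ∣ block {suc k} F.zero ∩ (Y ++ Z) ∣ ≡ ∣ Y ∣
  ∣block₀∩Y++Z∣≡∣Y∣ {k} Y Z = begin
    ∣ (⊤ {T} ++ ⊥) ∩ (Y ++ Z) ∣  ≡⟨ ∣p++q∩r++s∣ (⊤ {T}) Y (⊥ {k * T}) Z ⟩
    ∣ ⊤ ∩ Y ∣ + ∣ ⊥ ∩ Z ∣        ≡⟨ cong₂ _+_ (cong ∣_∣ (∩-identityˡ Y)) (∣⊥∩p∣≡0 Z) ⟩
    ∣ Y ∣ + 0                    ≡⟨ +-identityʳ _ ⟩
    ∣ Y ∣                        ∎

  ∣blockₛ∩Y++Z∣≡∣block∩Z∣ : ∀ {k} (i : Fin k) (Y : Subset T) (Z : Subset (k * T)) →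
    ∣ block {suc k} (F.suc i) ∩ (Y ++ Z) ∣ ≡ ∣ block i ∩ Z ∣
  ∣blockₛ∩Y++Z∣≡∣block∩Z∣ i Y Z =
    trans (∣p++q∩r++s∣ (⊥ {T}) Y (block i) Z) (cong (_+ ∣ block i ∩ Z ∣) (∣⊥∩p∣≡0 Y))

  ∣block₀─Y++Z∣≡∣∁Y∣ : ∀ {k} (Y : Subset T) (Z : Subset (k * T)) →
    ∣ block {suc k} F.zero ─ (Y ++ Z) ∣ ≡ ∣ ∁ Y ∣
  ∣block₀─Y++Z∣≡∣∁Y∣ {k} Y Z = begin
    ∣ (⊤ {T} ++ ⊥) ─ (Y ++ Z) ∣  ≡⟨ ∣p++q─r++s∣ (⊤ {T}) Y (⊥ {k * T}) Z ⟩
    ∣ ⊤ ─ Y ∣ + ∣ ⊥ ─ Z ∣        ≡⟨ cong₂ _+_ (cong ∣_∣ (⊤─p≡∁p Y)) (cong ∣_∣ (⊥─p≡⊥ Z)) ⟩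
    ∣ ∁ Y ∣ + ∣ ⊥ {k * T} ∣      ≡⟨ cong (∣ ∁ Y ∣ +_) (∣⊥∣≡0 (k * T)) ⟩
    ∣ ∁ Y ∣ + 0                  ≡⟨ +-identityʳ _ ⟩
    ∣ ∁ Y ∣                      ∎

  ∣blockₛ─Y++Z∣≡∣block─Z∣ : ∀ {k} (i : Fin k) (Y : Subset T) (Z : Subset (k * T)) →
    ∣ block {suc k} (F.suc i) ─ (Y ++ Z) ∣ ≡ ∣ block i ─ Z ∣
  ∣blockₛ─Y++Z∣≡∣block─Z∣ i Y Z =
    trans (∣p++q─r++s∣ (⊥ {T}) Y (block i) Z)
          (cong (_+ ∣ block i ─ Z ∣) (trans (cong ∣_∣ (⊥─p≡⊥ Y)) (∣⊥∣≡0 T)))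

  ∣block∣≡T : ∀ {k} (i : Fin k) → ∣ block i ∣ ≡ T
  ∣block∣≡T {suc k} F.zero    = begin
    ∣ ⊤ {T} ++ ⊥ ∣             ≡⟨ ∣p++q∣≡∣p∣+∣q∣ (⊤ {T}) (⊥ {k * T}) ⟩
    ∣ ⊤ {T} ∣ + ∣ ⊥ {k * T} ∣  ≡⟨ cong₂ _+_ (∣⊤∣≡n T) (∣⊥∣≡0 (k * T)) ⟩
    T + 0                      ≡⟨ +-identityʳ T ⟩
    T                          ∎
  ∣block∣≡T {suc k} (F.suc i) =
    trans (∣p++q∣≡∣p∣+∣q∣ (⊥ {T}) (block i)) (cong₂ _+_ (∣⊥∣≡0 T) (∣block∣≡T i))

  ∣block∩block∣≡0 : ∀ {k} (i j : Fin k) → i ≢ j → ∣ block i ∩ block j ∣ ≡ 0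
  ∣block∩block∣≡0         F.zero    F.zero    i≢j = contradiction refl i≢j
  ∣block∩block∣≡0 {suc k} F.zero    (F.suc j) _   =
    trans (∣block₀∩Y++Z∣≡∣Y∣ {k} ⊥ (block j)) (∣⊥∣≡0 T)
  ∣block∩block∣≡0 {suc k} (F.suc i) F.zero    _   =
    trans (∣blockₛ∩Y++Z∣≡∣block∩Z∣ i ⊤ ⊥) (∣p∩⊥∣≡0 (block i))
  ∣block∩block∣≡0 {suc k} (F.suc i) (F.suc j) i≢j =
    trans (∣blockₛ∩Y++Z∣≡∣block∩Z∣ i ⊥ (block j)) (∣block∩block∣≡0 i j (i≢j ∘ cong F.suc))

  ∣block∩X∣≥a⇒∣X∣≥k*a : ∀ k {a} (X : Subset (k * T)) →
    (∀ (i : Fin k) → a ≤ ∣ block i ∩ X ∣) → k * a ≤ ∣ X ∣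
  ∣block∩X∣≥a⇒∣X∣≥k*a zero    X _ = z≤n
  ∣block∩X∣≥a⇒∣X∣≥k*a (suc k) X a≤ with splitAt T X
  ... | Y , Z , refl = subst (_ ≤_) (sym (∣p++q∣≡∣p∣+∣q∣ Y Z)) (+-mono-≤
    (subst (_ ≤_) (∣block₀∩Y++Z∣≡∣Y∣ {k} Y Z) (a≤ F.zero))
    (∣block∩X∣≥a⇒∣X∣≥k*a k Z λ i → subst (_ ≤_) (∣blockₛ∩Y++Z∣≡∣block∩Z∣ i Y Z) (a≤ (F.suc i))))

  ∣block─concat-replicate∣ : ∀ {k} (i : Fin k) (Y : Subset T) →
    ∣ block i ─ concat (replicate k Y) ∣ ≡ ∣ ∁ Y ∣
  ∣block─concat-replicate∣ {suc k} F.zero    Y = ∣block₀─Y++Z∣≡∣∁Y∣ {k} Y (concat (replicate k Y))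
  ∣block─concat-replicate∣ {suc k} (F.suc i) Y =
    trans (∣blockₛ─Y++Z∣≡∣block─Z∣ i Y _) (∣block─concat-replicate∣ i Y)

  module Periodic (P : Vec (Fin 3) T) (k : ℕ) where

    colouring : Fin (k * T) → Fin 3
    colouring = lookup (concat (replicate k P))

    part-colouring : ∀ i → part colouring i ≡ concat (replicate k (map (isColour i) P))
    part-colouring i = begin
      part colouring i                                 ≡⟨ part-lookup (concat (replicate k P)) i ⟩
      map (isColour i) (concat (replicate k P))        ≡⟨ map-concat (isColour i) (replicate k P) ⟩
      concat (map (map (isColour i)) (replicate k P))  ≡⟨ cong concat (map-replicate (map (isColour i)) P k) ⟩
      concat (replicate k (map (isColour i) P))        ∎

    ∣part-colouring∣ : ∀ i → ∣ part colouring i ∣ ≡ k * ∣ map (isColour i) P ∣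
    ∣part-colouring∣ i =
      trans (cong ∣_∣ (part-colouring i)) (∣concat-replicate∣ k (map (isColour i) P))

    ∣block─part-colouring∣ : ∀ (j : Fin k) i →
      ∣ block j ─ part colouring i ∣ ≡ T ∸ ∣ map (isColour i) P ∣
    ∣block─part-colouring∣ j i = begin
      ∣ block j ─ part colouring i ∣
        ≡⟨ cong (λ X → ∣ block j ─ X ∣) (part-colouring i) ⟩
      ∣ block j ─ concat (replicate k (map (isColour i) P)) ∣
        ≡⟨ ∣block─concat-replicate∣ j (map (isColour i) P) ⟩
      ∣ ∁ (map (isColour i) P) ∣
        ≡⟨ ∣∁p∣≡n∸∣p∣ (map (isColour i) P) ⟩
      T ∸ ∣ map (isColour i) P ∣ ∎

module _ {t : ℕ} where
  open Blocks (suc t)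

  block-injective : ∀ {k} → Injective _≡_ _≡_ (block {k})
  block-injective {suc k} {F.zero}  {F.zero}  _  = refl
  block-injective {suc k} {F.zero}  {F.suc j} ()
  block-injective {suc k} {F.suc i} {F.zero}  ()
  block-injective {suc k} {F.suc i} {F.suc j} eq =
    cong F.suc (block-injective (++-injectiveʳ ⊥ ⊥ eq))

  block-nonempty : ∀ {k} (i : Fin k) → Nonempty (block i)
  block-nonempty {suc k} F.zero    = F.zero , here
  block-nonempty {suc k} (F.suc i) = ++-nonemptyʳ ⊥ (block-nonempty i)

blocks : (k t : ℕ) → Hypergraph
blocks k t = record
  { n = k * suc t ; m = k ; edge = block ; edge-inj = block-injective ; edge-ne = block-nonempty }
  where open Blocks (suc t)

stripes : ∀ a b → Vec (Fin 3) (a + (b + b))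
stripes a b = replicate a (# 0) ++ replicate b (# 1) ++ replicate b (# 2)

map-stripes : ∀ {B : Set} (f : Fin 3 → B) a b →
  map f (stripes a b) ≡ replicate a (f (# 0)) ++ replicate b (f (# 1)) ++ replicate b (f (# 2))
map-stripes f a b = begin
  map f (replicate a (# 0) ++ replicate b (# 1) ++ replicate b (# 2))
    ≡⟨ map-++ f (replicate a (# 0)) _ ⟩
  map f (replicate a (# 0)) ++ map f (replicate b (# 1) ++ replicate b (# 2))
    ≡⟨ cong₂ _++_ (map-replicate f (# 0) a) (map-++ f (replicate b (# 1)) _) ⟩
  replicate a (f (# 0)) ++ map f (replicate b (# 1)) ++ map f (replicate b (# 2))
    ≡⟨ cong (replicate a (f (# 0)) ++_) (cong₂ _++_ (map-replicate f (# 1) b) (map-replicate f (# 2) b)) ⟩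
  replicate a (f (# 0)) ++ replicate b (f (# 1)) ++ replicate b (f (# 2)) ∎

∣map-stripes∣ : ∀ (f : Fin 3 → Bool) a b → ∣ map f (stripes a b) ∣
  ≡ ∣ replicate a (f (# 0)) ∣ + (∣ replicate b (f (# 1)) ∣ + ∣ replicate b (f (# 2)) ∣)
∣map-stripes∣ f a b = begin
  ∣ map f (stripes a b) ∣
    ≡⟨ cong ∣_∣ (map-stripes f a b) ⟩
  ∣ replicate a (f (# 0)) ++ replicate b (f (# 1)) ++ replicate b (f (# 2)) ∣
    ≡⟨ ∣p++q∣≡∣p∣+∣q∣ (replicate a (f (# 0))) _ ⟩
  ∣ replicate a (f (# 0)) ∣ + ∣ replicate b (f (# 1)) ++ replicate b (f (# 2)) ∣
    ≡⟨ cong (∣ replicate a (f (# 0)) ∣ +_) (∣p++q∣≡∣p∣+∣q∣ (replicate b (f (# 1))) _) ⟩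
  ∣ replicate a (f (# 0)) ∣ + (∣ replicate b (f (# 1)) ∣ + ∣ replicate b (f (# 2)) ∣) ∎

ColourProfile : ∀ {T} → Vec (Fin 3) T → ℕ → ℕ → Set
ColourProfile P a b =
  ∣ map (isColour (# 0)) P ∣ ≡ a × ∣ map (isColour (# 1)) P ∣ ≡ b × ∣ map (isColour (# 2)) P ∣ ≡ b

stripes-profile : ∀ a b → ColourProfile (stripes a b) a b
stripes-profile a b =
    trans (∣map-stripes∣ _ a b)
          (trans (cong₂ _+_ (∣⊤∣≡n a) (cong₂ _+_ (∣⊥∣≡0 b) (∣⊥∣≡0 b))) (+-identityʳ a))
  , trans (∣map-stripes∣ _ a b)
          (trans (cong₂ _+_ (∣⊥∣≡0 a) (cong₂ _+_ (∣⊤∣≡n b) (∣⊥∣≡0 b))) (+-identityʳ b))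
  , trans (∣map-stripes∣ _ a b) (cong₂ _+_ (∣⊥∣≡0 a) (cong₂ _+_ (∣⊥∣≡0 b) (∣⊤∣≡n b)))

profile-exists : ∀ {T a b} → T ≡ a + (b + b) → Σ (Vec (Fin 3) T) λ P → ColourProfile P a b
profile-exists {a = a} {b} refl = stripes a b , stripes-profile a b

cd2×ecd2-blocks : ∀ k t {a b l} → suc t ≡ a + (b + b) → a + b ≡ suc l →
  cd2 (blocks k t) l (k * a) × ecd2 (blocks k t) l (k * a)
cd2×ecd2-blocks k t {a} {b} {l} T≡a+2b a+b≡1+l with profile-exists T≡a+2b
... | P , ∣P₀∣≡a , ∣P₁∣≡b , ∣P₂∣≡b =
  cd2×ecd2-intro {blocks k t} colouring good balanced ∣X₀∣≡ka lower
  where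
  open Blocks (suc t)
  open Periodic P k

  lower : ∀ h → Good (blocks k t) l h → k * a ≤ ∣ part h (# 0) ∣
  lower h good-h = ∣block∩X∣≥a⇒∣X∣≥k*a k (part h (# 0)) λ i →
    Good⇒a≤∣e∩X₀∣ {blocks k t} {g = h} good-h a+b≡1+l i (trans (∣block∣≡T i) T≡a+2b)

  ∣X₀∣≡ka : ∣ part colouring (# 0) ∣ ≡ k * a
  ∣X₀∣≡ka = trans (∣part-colouring∣ (# 0)) (cong (k *_) ∣P₀∣≡a)

  ∣Pᵢ∣≡b : ∀ i → i ≢ F.zero → ∣ map (isColour i) P ∣ ≡ b
  ∣Pᵢ∣≡b F.zero               0≢0 = contradiction refl 0≢0
  ∣Pᵢ∣≡b (F.suc F.zero)         _ = ∣P₁∣≡b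
  ∣Pᵢ∣≡b (F.suc (F.suc F.zero)) _ = ∣P₂∣≡b

  good : Good (blocks k t) l colouring
  good j i i≢0 ≤l = 1+n≰n (subst (_≤ l) ∣e─Xᵢ∣≡1+l ≤l)
    where
    ∣e─Xᵢ∣≡1+l : ∣ block j ─ part colouring i ∣ ≡ suc l
    ∣e─Xᵢ∣≡1+l = begin
      ∣ block j ─ part colouring i ∣  ≡⟨ ∣block─part-colouring∣ j i ⟩
      suc t ∸ ∣ map (isColour i) P ∣  ≡⟨ cong₂ _∸_ T≡a+2b (∣Pᵢ∣≡b i i≢0) ⟩
      a + (b + b) ∸ b                 ≡⟨ cong (_∸ b) (+-assoc a b b) ⟨
      a + b + b ∸ b                   ≡⟨ m+n∸n≡m (a + b) b ⟩
      a + b                           ≡⟨ a+b≡1+l ⟩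
      suc l                           ∎

  balanced : Balanced colouring
  balanced = subst₂ (λ u v → u ≤ suc v) (sym ∣X₁∣) (sym ∣X₂∣) (n≤1+n _)
           , subst₂ (λ u v → u ≤ suc v) (sym ∣X₂∣) (sym ∣X₁∣) (n≤1+n _)
    where
    ∣X₁∣ = trans (∣part-colouring∣ (# 1)) (cong (k *_) ∣P₁∣≡b)
    ∣X₂∣ = trans (∣part-colouring∣ (# 2)) (cong (k *_) ∣P₂∣≡b)

half<l⇒s≤2l : ∀ {s l} → 2 ∣ s → suc (s / 2) ≤ l → s ≤ 2 * l
half<l⇒s≤2l {s} {l} 2∣s half<l =
  subst₂ _≤_ (m/n*n≡m 2∣s) (*-comm l 2) (*-monoˡ-≤ 2 (≤-trans (n≤1+n (s / 2)) half<l))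

stripe-widths : ∀ {s l} → s ≤ 2 * l → l ≤ s →
  suc s ≡ (2 * l ∸ s + 1) + ((s ∸ l) + (s ∸ l)) × (2 * l ∸ s + 1) + (s ∸ l) ≡ suc l
stripe-widths {s} {l} s≤2l l≤s = suc-s≡a+2b , a+b≡1+l
  where
  x = 2 * l ∸ s
  b = s ∸ l
  x+b≡l : x + b ≡ l
  x+b≡l = +-cancelʳ-≡ l (x + b) l (begin
    x + b + l    ≡⟨ +-assoc x b l ⟩
    x + (b + l)  ≡⟨ cong (x +_) (m∸n+n≡m l≤s) ⟩
    x + s        ≡⟨ m∸n+n≡m s≤2l ⟩
    2 * l        ≡⟨ cong (l +_) (+-identityʳ l) ⟩
    l + l        ∎)
  a+b≡1+l : x + 1 + b ≡ suc l
  a+b≡1+l = trans (solve 2 (λ x b → x :+ con 1 :+ b := con 1 :+ (x :+ b)) refl x b) (cong suc x+b≡l)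
  suc-s≡a+2b : suc s ≡ x + 1 + (b + b)
  suc-s≡a+2b = begin
    suc s              ≡⟨ cong suc (m∸n+n≡m l≤s) ⟨
    suc (b + l)        ≡⟨ cong (λ l → suc (b + l)) x+b≡l ⟨
    suc (b + (x + b))  ≡⟨ solve 2 (λ x b → con 1 :+ (b :+ (x :+ b)) := x :+ con 1 :+ (b :+ b)) refl x b ⟩
    x + 1 + (b + b)    ∎

theorem3 : (k s : ℕ) → 1 ≤ k → 1 ≤ s → 2 ∣ s →
    Σ Hypergraph λ F →
      ((j : _) → s < ∣ edge F j ∣)
      × chiKG2 F s k
      × ((l : ℕ) → suc (s / 2) ≤ l → l ≤ s →
           cd2 F l (k * (2 * l ∸ s + 1)) × ecd2 F l (k * (2 * l ∸ s + 1)))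
theorem3 k s _ _ 2∣s = blocks k s , edges-large , chiKG2-blocks , cd-ecd
  where
  open Blocks (suc s)

  edges-large : (j : Fin k) → s < ∣ block j ∣
  edges-large j = ≤-reflexive (sym (∣block∣≡T j))

  chiKG2-blocks : chiKG2 (blocks k s) s k
  chiKG2-blocks = pairwise-small⇒chiKG2≡m (blocks k s) λ i j i≢j →
    subst (_≤ s) (sym (∣block∩block∣≡0 i j i≢j)) z≤n

  cd-ecd : (l : ℕ) → suc (s / 2) ≤ l → l ≤ s →
    cd2 (blocks k s) l (k * (2 * l ∸ s + 1)) × ecd2 (blocks k s) l (k * (2 * l ∸ s + 1))
  cd-ecd l half<l l≤s =
    let T≡a+2b , a+b≡1+l = stripe-widths (half<l⇒s≤2l 2∣s half<l) l≤s
    in  cd2×ecd2-blocks k s T≡a+2b a+b≡1+l
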